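{- Let $n\ge 4$ be an integer. Then $C_{tr}(K_n)=n$, where $K_n$ is the complete graph on $n$ vertices.
   Context: A set $S\subseteq V$ is a total restrained dominating set (TRD-set) of $G=(V,E)$ if every vertex of $V\setminus S$ is adjacent to at least one vertex of $S$ and to at least one other vertex of $V\setminus S$, and every vertex of $S$ is adjacent to at least one other vertex of $S$. Two disjoint sets $X,Y\subseteq V$ form a total restrained coalition if neither is a TRD-set but $X\cup Y$ is a TRD-set. A trc-partition of $G$ is a partition $\Phi$ of $V$ such that no member of $\Phi$ is a TRD-set and each member forms a total restrained coalition with some other member of $\Phi$. $C_{tr}(G)$ is the maximum cardinality of a trc-partition of $G$. -}

module Defs where

open import Data.Nat using (ℕ; _≤_)
open import Data.Fin using (Fin)
open import Data.Product using (Σ; ∃; ∃-syntax; _×_; _,_)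
open import Data.Sum using (_⊎_)
open import Data.Empty using (⊥)
open import Relation.Nullary using (¬_)
open import Relation.Binary.PropositionalEquality using (_≡_; refl; sym)

record Graph (n : ℕ) : Set₁ where
  field
    Adj       : Fin n → Fin n → Set
    irrefl    : ∀ {u} → ¬ Adj u u
    symmetric : ∀ {u v} → Adj u v → Adj v u
open Graph public

K : (n : ℕ) → Graph n
K n = record
  { Adj       = λ u v → ¬ u ≡ v
  ; irrefl    = λ p → p refl
  ; symmetric = λ p q → p (sym q)
  }

VSet : ℕ → Set₁
VSet n = Fin n → Set

IsTRD : ∀ {n} → Graph n → VSet n → Set
IsTRD {n} G S =
  (∀ v → ¬ S v →
     (∃[ u ] (S u × Adj G v u)) × (∃[ w ] (¬ S w × Adj G v w)))
  × (∀ v → S v → ∃[ u ] (S u × Adj G v u))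

_∪_ : ∀ {n} → VSet n → VSet n → VSet n
(X ∪ Y) v = X v ⊎ Y v

Disjoint : ∀ {n} → VSet n → VSet n → Set
Disjoint {n} X Y = ∀ (v : Fin n) → X v → Y v → ⊥

TRCoalition : ∀ {n} → Graph n → VSet n → VSet n → Set
TRCoalition G X Y =
  Disjoint X Y × ¬ IsTRD G X × ¬ IsTRD G Y × IsTRD G (X ∪ Y)

Part : ∀ {n k} → (Fin n → Fin k) → Fin k → VSet n
Part p i v = p v ≡ i

IsTRCPartition : ∀ {n} (G : Graph n) (k : ℕ) → (Fin n → Fin k) → Set
IsTRCPartition G k p =
  (∀ i → ∃[ v ] (p v ≡ i))
  × (∀ i → ¬ IsTRD G (Part p i))
  × (∀ i → ∃[ j ] (¬ i ≡ j × TRCoalition G (Part p i) (Part p j)))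

HasTRCPartition : ∀ {n} → Graph n → ℕ → Set
HasTRCPartition {n} G k = Σ (Fin n → Fin k) (IsTRCPartition G k)

CtrIs : ∀ {n} → Graph n → ℕ → Set
CtrIs G m = HasTRCPartition G m × (∀ k → HasTRCPartition G k → k ≤ m)

-- The partition of K_n into singletons is a trc-partition: a singleton is never a
-- TRD-set, since its vertex has no neighbour inside it, while any two vertices of K_n
-- form a TRD-set once n ≥ 4, as every outside vertex sees both of them and still has an
-- outside neighbour. No partition can have more than n nonempty parts.
module Submission where

open import Defs
open import Data.Nat using (ℕ; _≤_; _<_; s≤s; z≤n)
open import Data.Nat.Properties using (<⇒≱; <-≤-trans)
open import Data.Fin using (Fin; zero; suc)
open import Data.Fin.Properties using (_≟_; any?; ¬∀⟶∃¬; injective⇒≤)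
open import Data.Product using (∃-syntax; _×_; _,_; proj₁; proj₂; map₂; curry)
open import Data.Sum using (_⊎_; inj₁; inj₂; [_,_])
open import Function using (id; _∘_)
open import Function.Definitions using (StrictlySurjective)
open import Relation.Nullary using (¬_)
open import Relation.Binary.PropositionalEquality using (_≡_; _≢_; refl; sym; trans; cong)

-- Choosing a preimage of each point is a right inverse, hence injective.
strictlySurjective⇒≤ : ∀ {m n} {f : Fin m → Fin n} → StrictlySurjective _≡_ f → n ≤ m
strictlySurjective⇒≤ {m} {n} {f} surj = injective⇒≤ {f = section} section-injective
  where
  section : Fin n → Fin m
  section y = proj₁ (surj y)
  section-injective : ∀ {x y} → section x ≡ section y → x ≡ y
  section-injective {x} {y} e =
    trans (sym (proj₂ (surj x))) (trans (cong f e) (proj₂ (surj y)))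

avoid : ∀ {k n} → k < n → (xs : Fin k → Fin n) → ∃[ w ] (∀ i → xs i ≢ w)
avoid {n = n} k<n xs =
  map₂ curry (¬∀⟶∃¬ n (λ w → ∃[ i ] (xs i ≡ w)) (λ w → any? (λ i → xs i ≟ w))
    (λ surj → <⇒≱ k<n (strictlySurjective⇒≤ surj)))

avoid-three : ∀ {n} → 4 ≤ n → (a b c : Fin n) → ∃[ w ] (a ≢ w × b ≢ w × c ≢ w)
avoid-three 4≤n a b c with avoid 4≤n (λ { zero → a ; (suc zero) → b ; (suc (suc zero)) → c })
... | w , ∉abc = w , ∉abc zero , ∉abc (suc zero) , ∉abc (suc (suc zero))

singleton-¬isTRD : ∀ {n} (G : Graph n) (i : Fin n) → ¬ IsTRD G (_≡ i)
singleton-¬isTRD G i (_ , total) with total i refl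
... | .i , refl , i~i = irrefl G i~i

pair-isTRD : ∀ {n} → 4 ≤ n → {i j : Fin n} → i ≢ j → IsTRD (K n) (λ v → v ≡ i ⊎ v ≡ j)
pair-isTRD {n} 4≤n {i} {j} i≢j = dominating , total
  where
  S : VSet n
  S v = v ≡ i ⊎ v ≡ j
  dominating : ∀ v → ¬ S v → (∃[ u ] (S u × v ≢ u)) × (∃[ w ] (¬ S w × v ≢ w))
  dominating v v∉ij with avoid-three 4≤n i j v
  ... | w , i≢w , j≢w , v≢w =
    (i , inj₁ refl , v∉ij ∘ inj₁) ,
    (w , [ i≢w ∘ sym , j≢w ∘ sym ] , v≢w)
  total : ∀ v → S v → ∃[ u ] (S u × v ≢ u)
  total v (inj₁ refl) = j , inj₂ refl , i≢j
  total v (inj₂ refl) = i , inj₁ refl , i≢j ∘ sym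

singletons-isTRCPartition : ∀ {n} → 4 ≤ n → IsTRCPartition (K n) n id
singletons-isTRCPartition {n} 4≤n = (λ i → i , refl) , singleton-¬isTRD (K n) , coalition
  where
  coalition : ∀ i → ∃[ j ] (i ≢ j × TRCoalition (K n) (Part id i) (Part id j))
  coalition i with avoid (<-≤-trans (s≤s (s≤s z≤n)) 4≤n) (λ _ → i)
  ... | j , i∉ = j , i≢j ,
    (λ v v≡i v≡j → i≢j (trans (sym v≡i) v≡j)) ,
    singleton-¬isTRD (K n) i , singleton-¬isTRD (K n) j , pair-isTRD 4≤n i≢j
    where
    i≢j : i ≢ j
    i≢j = i∉ zero

trcPartition-size≤ : ∀ {n k} (G : Graph n) → HasTRCPartition G k → k ≤ n
trcPartition-size≤ G (_ , nonempty , _) = strictlySurjective⇒≤ nonempty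

proposition3p4 : (n : ℕ) → 4 ≤ n → CtrIs (K n) n
proposition3p4 n 4≤n =
  (id , singletons-isTRCPartition 4≤n) , λ k → trcPartition-size≤ (K n)
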